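{- Every $\mathrm{LTL}(\sim)$-formula that does not contain the operator $\mathsf X$ is stutter-invariant, i.e. for all teams $T,T'$ with $T\equiv_{\mathrm{st}}T'$ we have $T\models\varphi$ iff $T'\models\varphi$.
   Context: A trace is an infinite sequence $t=t(0)t(1)\cdots$ of subsets of a set $\mathsf{AP}$ of propositions; $t^i=t(i)t(i+1)\cdots$. A team is a set of traces; $T^i=\{t^i\mid t\in T\}$. $\mathrm{LTL}(\sim)$-formulas: $\varphi::=p\mid\neg\varphi\mid\varphi\wedge\varphi\mid\varphi\vee\varphi\mid\mathsf X\varphi\mid\mathsf F\varphi\mid\mathsf G\varphi\mid\varphi\mathsf U\varphi\mid\varphi\mathsf R\varphi\mid{\sim}\varphi$ with semantics: $T\models p$ iff $p\in t(0)$ for all $t\in T$; $T\models\neg\varphi$ iff $\{t\}\not\models\varphi$ for all $t\in T$; $\wedge$ as usual; $T\models\varphi\vee\psi$ iff $T=S\cup U$ with $S\models\varphi$, $U\models\psi$; $T\models\mathsf X\varphi$ iff $T^1\models\varphi$; $T\models\mathsf F\varphi$ iff $\exists k\,T^k\models\varphi$; $T\models\mathsf G\varphi$ iff $\forall k\,T^k\models\varphi$; $T\models\varphi\mathsf U\psi$ iff $\exists k(T^k\models\psi\wedge\forall j<k\,T^j\models\varphi)$; $T\models\varphi\mathsf R\psi$ iff $\forall k(T^k\models\psi\vee\exists j<k\,T^j\models\varphi)$; $T\models{\sim}\varphi$ iff $T\not\models\varphi$. A stuttering function of a trace $t$ is a strictly increasing $f:\mathbb N\to\mathbb N$ with $f(0)=0$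 and $t(f(k))=\cdots=t(f(k+1)-1)$ for all $k$; of a team, if it is one for each of its traces. $t[f]=t(f(0))t(f(1))\cdots$, $T[f]=\{t[f]\mid t\in T\}$; $T\equiv_{\mathrm{st}}T'$ iff $T[f]=T'[f']$ for some stuttering functions $f$ of $T$ and $f'$ of $T'$. -}

module Defs where

open import Data.Nat using (ℕ; zero; suc; _+_; _≤_; _<_)
open import Data.Bool using (Bool; true)
open import Data.Product using (Σ; ∃; _×_; _,_)
open import Data.Sum using (_⊎_)
open import Data.Empty using (⊥)
open import Relation.Nullary using (¬_)
open import Relation.Binary.PropositionalEquality using (_≡_)
open import Function.Bundles using (_⇔_)
open import Level using (0ℓ)

module _ (AP : Set) where

  Letter : Set
  Letter = AP → Bool

  _≈L_ : Letter → Letter → Set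
  a ≈L b = ∀ p → a p ≡ b p

  Trace : Set
  Trace = ℕ → Letter

  _≈T_ : Trace → Trace → Set
  s ≈T t = ∀ i → s i ≈L t i

  Team : Set₁
  Team = Trace → Set

  _≐_ : Team → Team → Set
  T ≐ U = ∀ t → T t ⇔ U t

  suffix : ℕ → Trace → Trace
  suffix k t i = t (k + i)

  teamSuffix : ℕ → Team → Team
  teamSuffix k T s = Σ Trace λ t → T t × (s ≈T suffix k t)

  singleton : Trace → Team
  singleton t s = s ≈T t

  _∪_ : Team → Team → Team
  (S ∪ U) t = S t ⊎ U t

data Formula (AP : Set) : Set where
  atom : AP → Formula AP
  ¬'_  : Formula AP → Formula AP
  _∧'_ : Formula AP → Formula AP → Formula AP
  _∨'_ : Formula AP → Formula AP → Formula AP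
  X    : Formula AP → Formula AP
  F    : Formula AP → Formula AP
  G    : Formula AP → Formula AP
  _U_  : Formula AP → Formula AP → Formula AP
  _R_  : Formula AP → Formula AP → Formula AP
  ∼_   : Formula AP → Formula AP

module _ {AP : Set} where

  infix 4 _⊨_
  _⊨_ : Team AP → Formula AP → Set₁
  T ⊨ atom p = Level.Lift (Level.suc 0ℓ) (∀ t → T t → t 0 p ≡ true)
  T ⊨ (¬' φ) = ∀ t → T t → ¬ (singleton AP t ⊨ φ)
  T ⊨ (φ ∧' ψ) = (T ⊨ φ) × (T ⊨ ψ)
  T ⊨ (φ ∨' ψ) = Σ (Team AP) λ S → Σ (Team AP) λ U →
                   Level.Lift (Level.suc 0ℓ) (_≐_ AP T (_∪_ AP S U)) × (S ⊨ φ) × (U ⊨ ψ)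
  T ⊨ X φ = teamSuffix AP 1 T ⊨ φ
  T ⊨ F φ = Σ ℕ λ k → teamSuffix AP k T ⊨ φ
  T ⊨ G φ = ∀ k → teamSuffix AP k T ⊨ φ
  T ⊨ (φ U ψ) = Σ ℕ λ k → (teamSuffix AP k T ⊨ ψ) × (∀ j → Level.Lift (Level.suc 0ℓ) (j < k) → teamSuffix AP j T ⊨ φ)
  T ⊨ (φ R ψ) = ∀ k → (teamSuffix AP k T ⊨ ψ) ⊎ (Σ ℕ λ j → Level.Lift (Level.suc 0ℓ) (j < k) × (teamSuffix AP j T ⊨ φ))
  T ⊨ (∼ φ) = ¬ (T ⊨ φ)

  data XFree : Formula AP → Set where
    atom : ∀ p → XFree (atom p)
    neg  : ∀ {φ} → XFree φ → XFree (¬' φ)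
    and  : ∀ {φ ψ} → XFree φ → XFree ψ → XFree (φ ∧' ψ)
    or   : ∀ {φ ψ} → XFree φ → XFree ψ → XFree (φ ∨' ψ)
    fut  : ∀ {φ} → XFree φ → XFree (F φ)
    glob : ∀ {φ} → XFree φ → XFree (G φ)
    until : ∀ {φ ψ} → XFree φ → XFree ψ → XFree (φ U ψ)
    release : ∀ {φ ψ} → XFree φ → XFree ψ → XFree (φ R ψ)
    sim  : ∀ {φ} → XFree φ → XFree (∼ φ)

  IsStutteringFn : (ℕ → ℕ) → Trace AP → Set
  IsStutteringFn f t =
    (∀ k → f k < f (suc k)) ×
    (f 0 ≡ 0) ×
    (∀ k i → f k ≤ i → i < f (suc k) → _≈L_ AP (t i) (t (f k)))

  IsTeamStutteringFn : (ℕ → ℕ) → Team AP → Set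
  IsTeamStutteringFn f T = ∀ t → T t → IsStutteringFn f t

  stutterTeam : Team AP → (ℕ → ℕ) → Team AP
  stutterTeam T f s = Σ (Trace AP) λ t → T t × _≈T_ AP s (λ k → t (f k))

  _≡st_ : Team AP → Team AP → Set
  T ≡st T' = Σ (ℕ → ℕ) λ f → Σ (ℕ → ℕ) λ f' →
    IsTeamStutteringFn f T × IsTeamStutteringFn f' T' ×
    _≐_ AP (stutterTeam T f) (stutterTeam T' f')

-- If j lies in the k-th block of a stuttering function f of T, i.e. f k ≤ j < f (k + 1),
-- then T^j and (T[f])^k are again stutter-equivalent, via f re-based at j. Hence by
-- induction on an X-free formula every temporal operator, whose quantifiers range over
-- suffixes, can move its witnesses between T and T[f] block by block; only X, which
-- steps into the middle of a block, breaks this.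

module Submission where

open import Defs
open import Data.Bool using (true)
open import Data.Nat
open import Data.Nat.Properties
open import Data.Product using (∃-syntax; _×_; _,_; proj₁; proj₂; swap)
open import Data.Product.Function.NonDependent.Propositional using (_×-⇔_)
open import Data.Sum using (inj₁; inj₂; [_,_])
open import Data.Empty using (⊥-elim)
open import Function using (_∘_)
open import Function.Bundles using (_⇔_; mk⇔; Equivalence)
import Function.Properties.Equivalence as ⇔
open import Function.Related.TypeIsomorphisms using (¬-cong-⇔)
open import Level using (lift)
open import Relation.Binary.Core using (_Preserves_⟶_)
open import Relation.Binary.PropositionalEquality using (_≡_; refl; sym; trans; cong; subst; subst₂; _≗_)
open import Relation.Nullary using (yes; no)

open Equivalence using (to; from)

m∸n≤o⇒m≤n+o : ∀ {m n o} → m ∸ n ≤ o → m ≤ n + o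
m∸n≤o⇒m≤n+o {m} {n} m∸n≤o = ≤-trans (m≤n+m∸n m n) (+-monoʳ-≤ n m∸n≤o)

o<m∸n⇒n+o<m : ∀ {m n o} → n ≤ m → o < m ∸ n → n + o < m
o<m∸n⇒n+o<m {n = n} {o} n≤m o<m∸n = subst (n + o <_) (m+[n∸m]≡n n≤m) (+-monoʳ-< n o<m∸n)

StrictlyIncreasing : (ℕ → ℕ) → Set
StrictlyIncreasing f = ∀ k → f k < f (suc k)

InBlock : (ℕ → ℕ) → ℕ → ℕ → Set
InBlock f k i = f k ≤ i × i < f (suc k)

module Increasing {f : ℕ → ℕ} (f-inc : StrictlyIncreasing f) where

  mono-< : f Preserves _<_ ⟶ _<_
  mono-< {k} {suc m} (s≤s k≤m) with m≤n⇒m<n∨m≡n k≤m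
  ... | inj₁ k<m  = <-trans (mono-< k<m) (f-inc m)
  ... | inj₂ refl = f-inc k

  mono-≤ : f Preserves _≤_ ⟶ _≤_
  mono-≤ k≤m with m≤n⇒m<n∨m≡n k≤m
  ... | inj₁ k<m  = <⇒≤ (mono-< k<m)
  ... | inj₂ refl = ≤-refl

  cancel-< : ∀ {k m} → f k < f m → k < m
  cancel-< {k} {m} fk<fm with k <? m
  ... | yes k<m = k<m
  ... | no  k≮m = ⊥-elim (<⇒≱ fk<fm (mono-≤ (≮⇒≥ k≮m)))

  anchor : ∀ k → InBlock f k (f k)
  anchor k = ≤-refl , f-inc k

  block : f 0 ≡ 0 → ∀ i → ∃[ k ] InBlock f k i
  block f0 zero = 0 , ≤-reflexive f0 , ≤-<-trans z≤n (f-inc 0)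
  block f0 (suc i) with block f0 i
  ... | k , fk≤i , i<f[1+k] with m≤n⇒m<n∨m≡n i<f[1+k]
  ... | inj₁ 1+i<f[1+k] = k , m≤n⇒m≤1+n fk≤i , 1+i<f[1+k]
  ... | inj₂ 1+i≡f[1+k] = suc k , ≤-reflexive (sym 1+i≡f[1+k])
                                , ≤-<-trans (≤-reflexive 1+i≡f[1+k]) (f-inc (suc k))

  block-< : ∀ {m i k} → InBlock f m i → i < f k → m < k
  block-< (fm≤i , _) i<fk = cancel-< (≤-<-trans fm≤i i<fk)

  <-block : ∀ {m k j} → m < k → InBlock f k j → f m < j
  <-block m<k (fk≤j , _) = <-≤-trans (mono-< m<k) fk≤j

open Increasing

-- A stuttering function of the empty team is arbitrary; strictify makes every function
-- strictly increasing while fixing those that already are and start at 0.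
strictify : (ℕ → ℕ) → ℕ → ℕ
strictify f zero    = 0
strictify f (suc k) = f (suc k) ⊔ suc (strictify f k)

strictify-inc : ∀ f → StrictlyIncreasing (strictify f)
strictify-inc f k = m≤n⊔m (f (suc k)) (suc (strictify f k))

strictify-≗ : ∀ {f} → StrictlyIncreasing f → f 0 ≡ 0 → strictify f ≗ f
strictify-≗ f-inc f0 zero    = sym f0
strictify-≗ f-inc f0 (suc k) rewrite strictify-≗ f-inc f0 k = m≥n⇒m⊔n≡m (f-inc k)

module Shift {f : ℕ → ℕ} (f-inc : StrictlyIncreasing f) {k j : ℕ} (j∈k : InBlock f k j) where

  shift : ℕ → ℕ
  shift zero    = 0
  shift (suc i) = f (k + suc i) ∸ j

  j<f[k+1+i] : ∀ i → j < f (k + suc i)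
  j<f[k+1+i] i = <-≤-trans (proj₂ j∈k) (mono-≤ f-inc (m<m+n k z<s))

  shift-inc : StrictlyIncreasing shift
  shift-inc zero    = m<n⇒0<n∸m (j<f[k+1+i] 0)
  shift-inc (suc i) = ∸-monoˡ-< (mono-< f-inc (+-monoʳ-< k (n<1+n (suc i)))) (<⇒≤ (j<f[k+1+i] i))

  <shift⇒<f : ∀ m {i} → i < shift (suc m) → j + i < f (suc (k + m))
  <shift⇒<f m {i} i<shift =
    subst (λ n → j + i < f n) (+-suc k m) (o<m∸n⇒n+o<m (<⇒≤ (j<f[k+1+i] m)) i<shift)

  shift-block : ∀ {m i} → InBlock shift m i → InBlock f (k + m) (j + i)
  shift-block {zero}  {i} (_ , i<shift) =
    subst (λ n → f n ≤ j + i) (sym (+-identityʳ k)) (≤-trans (proj₁ j∈k) (m≤m+n j i)) ,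
    <shift⇒<f 0 i<shift
  shift-block {suc m} (shift≤i , i<shift) = m∸n≤o⇒m≤n+o shift≤i , <shift⇒<f (suc m) i<shift

  shift-anchor : ∀ m → InBlock f (k + m) (j + shift m)
  shift-anchor m = shift-block (anchor shift-inc m)

module _ {AP : Set} where

  private
    infix 4 _≈_
    _≈_ : Trace AP → Trace AP → Set
    _≈_ = _≈T_ AP

  ≈-refl : ∀ {s} → s ≈ s
  ≈-refl i p = refl

  ≈-sym : ∀ {s t} → s ≈ t → t ≈ s
  ≈-sym s≈t i p = sym (s≈t i p)

  ≈-trans : ∀ {s t u} → s ≈ t → t ≈ u → s ≈ u
  ≈-trans s≈t t≈u i p = trans (s≈t i p) (t≈u i p)

  stutters-in-block : ∀ {f t k i} → IsStutteringFn f t → InBlock f k i → _≈L_ AP (t i) (t (f k))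
  stutters-in-block (_ , _ , stutters) (lo , hi) = stutters _ _ lo hi

  same-block : ∀ {f t k i i′} → IsStutteringFn f t → InBlock f k i → InBlock f k i′ →
               _≈L_ AP (t i) (t i′)
  same-block st i∈k i′∈k p = trans (stutters-in-block st i∈k p) (sym (stutters-in-block st i′∈k p))

  IsStutteringFn-resp-≈ : ∀ {f s t} → s ≈ t → IsStutteringFn f t → IsStutteringFn f s
  IsStutteringFn-resp-≈ s≈t (f-inc , f0 , stutters) = f-inc , f0 , λ k i lo hi p →
    trans (s≈t i p) (trans (stutters k i lo hi p) (sym (s≈t _ p)))

  IsStutteringFn-resp-≗ : ∀ {f g} {t : Trace AP} → g ≗ f → IsStutteringFn f t → IsStutteringFn g t
  IsStutteringFn-resp-≗ {t = t} g≗f (f-inc , f0 , stutters) =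
    (λ k → subst₂ _<_ (sym (g≗f k)) (sym (g≗f (suc k))) (f-inc k)) ,
    trans (g≗f 0) f0 ,
    λ k i lo hi p → subst (λ n → t i p ≡ t n p) (sym (g≗f k))
      (stutters k i (subst (_≤ i) (g≗f k) lo) (subst (i <_) (g≗f (suc k)) hi) p)

  _⊆_ : Team AP → Team AP → Set
  S ⊆ T = ∀ {t} → S t → T t

  ∪-⊆ˡ : ∀ {T S₁ S₂} → _≐_ AP T (_∪_ AP S₁ S₂) → S₁ ⊆ T
  ∪-⊆ˡ T≐S S₁t = from (T≐S _) (inj₁ S₁t)

  ∪-⊆ʳ : ∀ {T S₁ S₂} → _≐_ AP T (_∪_ AP S₁ S₂) → S₂ ⊆ T
  ∪-⊆ʳ T≐S S₂t = from (T≐S _) (inj₂ S₂t)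

  stuttering-⊆ : ∀ {f S T} → S ⊆ T → IsTeamStutteringFn f T → IsTeamStutteringFn f S
  stuttering-⊆ S⊆T st t St = st t (S⊆T St)

  -- The teams of Defs are predicates, not closed under ≈; satisfaction only sees
  -- them up to this similarity.
  _≲_ : Team AP → Team AP → Set
  T ≲ V = ∀ t → T t → ∃[ u ] V u × t ≈ u

  _≃_ : Team AP → Team AP → Set
  T ≃ V = T ≲ V × V ≲ T

  ≃-sym : ∀ {T V} → T ≃ V → V ≃ T
  ≃-sym = swap

  ≐⇒≃ : ∀ {T V} → _≐_ AP T V → T ≃ V
  ≐⇒≃ T≐V = (λ t Tt → t , to (T≐V t) Tt , ≈-refl) , (λ u Vu → u , from (T≐V u) Vu , ≈-refl)

  singleton-≃ : ∀ {s t} → s ≈ t → singleton AP s ≃ singleton AP t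
  singleton-≃ s≈t = (λ x x≈s → _ , ≈-refl , ≈-trans x≈s s≈t)
                  , (λ y y≈t → _ , ≈-refl , ≈-trans y≈t (≈-sym s≈t))

  teamSuffix-≲ : ∀ k {T V} → T ≲ V → teamSuffix AP k T ≲ teamSuffix AP k V
  teamSuffix-≲ k T≲V s (t , Tt , s≈tᵏ) =
    let u , Vu , t≈u = T≲V t Tt
    in suffix AP k u , (u , Vu , ≈-refl) , ≈-trans s≈tᵏ (λ i → t≈u (k + i))

  teamSuffix-≃ : ∀ k {T V} → T ≃ V → teamSuffix AP k T ≃ teamSuffix AP k V
  teamSuffix-≃ k (T≲V , V≲T) = teamSuffix-≲ k T≲V , teamSuffix-≲ k V≲T

  restrict : (Trace AP → Trace AP → Set) → Team AP → Team AP → Team AP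
  restrict _∼ᵗ_ V S u = V u × ∃[ t ] S t × t ∼ᵗ u

  restrict-∪ : ∀ _∼ᵗ_ {T V S₁ S₂} → (∀ u → V u → ∃[ t ] T t × t ∼ᵗ u) →
               _≐_ AP T (_∪_ AP S₁ S₂) →
               _≐_ AP V (_∪_ AP (restrict _∼ᵗ_ V S₁) (restrict _∼ᵗ_ V S₂))
  restrict-∪ _∼ᵗ_ {V = V} {S₁} {S₂} covered T≐S u = mk⇔ split [ proj₁ , proj₁ ]
    where
      split : V u → _∪_ AP (restrict _∼ᵗ_ V S₁) (restrict _∼ᵗ_ V S₂) u
      split Vu with covered u Vu
      ... | t , Tt , t∼u with to (T≐S t) Tt
      ... | inj₁ S₁t = inj₁ (Vu , t , S₁t , t∼u)
      ... | inj₂ S₂t = inj₂ (Vu , t , S₂t , t∼u)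

  restrict-≃ : ∀ {S T V} → S ⊆ T → T ≲ V → S ≃ restrict _≈_ V S
  restrict-≃ S⊆T T≲V =
    (λ s Ss → let u , Vu , s≈u = T≲V s (S⊆T Ss) in u , (Vu , s , Ss , s≈u) , s≈u) ,
    (λ u (Vu , t , St , t≈u) → t , St , ≈-sym t≈u)

  ⊨-resp-≃ : ∀ φ {T V} → T ≃ V → T ⊨ φ → V ⊨ φ
  ⊨-resp-≃ (atom p) (_ , V≲T) (lift T⊨p) = lift λ u Vu →
    let t , Tt , u≈t = V≲T u Vu in trans (u≈t 0 p) (T⊨p t Tt)
  ⊨-resp-≃ (¬' φ) (_ , V≲T) T⊨¬φ u Vu u⊨φ =
    let t , Tt , u≈t = V≲T u Vu in T⊨¬φ t Tt (⊨-resp-≃ φ (singleton-≃ u≈t) u⊨φ)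
  ⊨-resp-≃ (φ ∧' ψ) T≃V (T⊨φ , T⊨ψ) = ⊨-resp-≃ φ T≃V T⊨φ , ⊨-resp-≃ ψ T≃V T⊨ψ
  ⊨-resp-≃ (φ ∨' ψ) {V = V} (T≲V , V≲T) (S₁ , S₂ , lift T≐S , S₁⊨φ , S₂⊨ψ) =
    restrict _≈_ V S₁ , restrict _≈_ V S₂ ,
    lift (restrict-∪ _≈_ (λ u Vu → let t , Tt , u≈t = V≲T u Vu in t , Tt , ≈-sym u≈t) T≐S) ,
    ⊨-resp-≃ φ (restrict-≃ (∪-⊆ˡ T≐S) T≲V) S₁⊨φ ,
    ⊨-resp-≃ ψ (restrict-≃ (∪-⊆ʳ T≐S) T≲V) S₂⊨ψ
  ⊨-resp-≃ (X φ) T≃V = ⊨-resp-≃ φ (teamSuffix-≃ 1 T≃V)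
  ⊨-resp-≃ (F φ) T≃V (k , Tᵏ⊨φ) = k , ⊨-resp-≃ φ (teamSuffix-≃ k T≃V) Tᵏ⊨φ
  ⊨-resp-≃ (G φ) T≃V T⊨Gφ k = ⊨-resp-≃ φ (teamSuffix-≃ k T≃V) (T⊨Gφ k)
  ⊨-resp-≃ (φ U ψ) T≃V (k , Tᵏ⊨ψ , before) =
    k , ⊨-resp-≃ ψ (teamSuffix-≃ k T≃V) Tᵏ⊨ψ ,
    λ j j<k → ⊨-resp-≃ φ (teamSuffix-≃ j T≃V) (before j j<k)
  ⊨-resp-≃ (φ R ψ) T≃V T⊨φRψ k with T⊨φRψ k
  ... | inj₁ Tᵏ⊨ψ            = inj₁ (⊨-resp-≃ ψ (teamSuffix-≃ k T≃V) Tᵏ⊨ψ)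
  ... | inj₂ (j , j<k , Tʲ⊨φ) = inj₂ (j , j<k , ⊨-resp-≃ φ (teamSuffix-≃ j T≃V) Tʲ⊨φ)
  ⊨-resp-≃ (∼ φ) T≃V T⊭φ V⊨φ = T⊭φ (⊨-resp-≃ φ (≃-sym T≃V) V⊨φ)

  ⊨-cong : ∀ φ {T V} → T ≃ V → (T ⊨ φ) ⇔ (V ⊨ φ)
  ⊨-cong φ T≃V = mk⇔ (⊨-resp-≃ φ T≃V) (⊨-resp-≃ φ (≃-sym T≃V))

  stutterTeam-≲ : ∀ {T f g} → (∀ t → T t → f ≗ g) → stutterTeam T f ≲ stutterTeam T g
  stutterTeam-≲ f≗g x (t , Tt , x≈t∘f) =
    _ , (t , Tt , ≈-refl) , ≈-trans x≈t∘f (λ i p → cong (λ n → t n p) (f≗g t Tt i))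

  stutterTeam-cong : ∀ {T f g} → (∀ t → T t → f ≗ g) → stutterTeam T f ≃ stutterTeam T g
  stutterTeam-cong f≗g = stutterTeam-≲ f≗g , stutterTeam-≲ (λ t Tt → sym ∘ f≗g t Tt)

  stutterTeam-∪ : ∀ {f T S₁ S₂} → _≐_ AP T (_∪_ AP S₁ S₂) →
                  _≐_ AP (stutterTeam T f) (_∪_ AP (stutterTeam S₁ f) (stutterTeam S₂ f))
  stutterTeam-∪ {f} {T} {S₁} {S₂} T≐S x = mk⇔ split merge
    where
      split : stutterTeam T f x → _∪_ AP (stutterTeam S₁ f) (stutterTeam S₂ f) x
      split (t , Tt , x≈t∘f) with to (T≐S t) Tt
      ... | inj₁ S₁t = inj₁ (t , S₁t , x≈t∘f)
      ... | inj₂ S₂t = inj₂ (t , S₂t , x≈t∘f)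
      merge : _∪_ AP (stutterTeam S₁ f) (stutterTeam S₂ f) x → stutterTeam T f x
      merge (inj₁ (t , S₁t , x≈t∘f)) = t , ∪-⊆ˡ T≐S S₁t , x≈t∘f
      merge (inj₂ (t , S₂t , x≈t∘f)) = t , ∪-⊆ʳ T≐S S₂t , x≈t∘f

  stutterTeam-restrict-≃ : ∀ {f T S} → S ⊆ stutterTeam T f →
                           stutterTeam (restrict (λ s t → s ≈ t ∘ f) T S) f ≃ S
  stutterTeam-restrict-≃ S⊆T[f] =
    (λ x (t , (Tt , s , Ss , s≈t∘f) , x≈t∘f) → s , Ss , ≈-trans x≈t∘f (≈-sym s≈t∘f)) ,
    (λ y Sy → let t , Tt , y≈t∘f = S⊆T[f] Sy in _ , (t , (Tt , y , Sy , y≈t∘f) , ≈-refl) , y≈t∘f)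

  singleton-stuttering : ∀ {f t} → IsStutteringFn f t → IsTeamStutteringFn f (singleton AP t)
  singleton-stuttering st u u≈t = IsStutteringFn-resp-≈ u≈t st

  stutterTeam-singleton-≃ : ∀ {f s t} → s ≈ t ∘ f → stutterTeam (singleton AP t) f ≃ singleton AP s
  stutterTeam-singleton-≃ {f} s≈t∘f =
    (λ x (t′ , t′≈t , x≈t′∘f) → _ , ≈-refl , ≈-trans x≈t′∘f (≈-trans (λ i → t′≈t (f i)) (≈-sym s≈t∘f))) ,
    (λ y y≈s → _ , (_ , ≈-refl , ≈-refl) , ≈-trans y≈s s≈t∘f)

  module _ {f : ℕ → ℕ} (f-inc : StrictlyIncreasing f) {k j : ℕ} (j∈k : InBlock f k j) where
    open Shift f-inc j∈k

    shifted-suffix : ∀ {t} → IsStutteringFn f t → suffix AP j t ∘ shift ≈ suffix AP k (t ∘ f)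
    shifted-suffix st i = stutters-in-block st (shift-anchor i)

    shift-stuttering : ∀ {T} → IsTeamStutteringFn f T → IsTeamStutteringFn shift (teamSuffix AP j T)
    shift-stuttering st s (t , Tt , s≈tʲ) = shift-inc , refl , λ m i lo hi p →
      trans (s≈tʲ i p)
            (trans (same-block (st t Tt) (shift-block (lo , hi)) (shift-anchor m) p) (sym (s≈tʲ _ p)))

    suffix-stutter-≃ : ∀ {T} → IsTeamStutteringFn f T →
                       stutterTeam (teamSuffix AP j T) shift ≃ teamSuffix AP k (stutterTeam T f)
    suffix-stutter-≃ st =
      (λ x (s , (t , Tt , s≈tʲ) , x≈s∘shift) →
         _ , (_ , (t , Tt , ≈-refl) , ≈-refl) ,
         ≈-trans x≈s∘shift (≈-trans (λ i → s≈tʲ (shift i)) (shifted-suffix (st t Tt)))) ,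
      (λ y (v , (t , Tt , v≈t∘f) , y≈vᵏ) →
         _ , (_ , (t , Tt , ≈-refl) , ≈-refl) ,
         ≈-trans y≈vᵏ (≈-trans (λ i → v≈t∘f (k + i)) (≈-sym (shifted-suffix (st t Tt)))))

  Stutter-⇔ : Formula AP → Set₁
  Stutter-⇔ φ = ∀ {T f} → StrictlyIncreasing f → f 0 ≡ 0 → IsTeamStutteringFn f T →
                (T ⊨ φ) ⇔ (stutterTeam T f ⊨ φ)

  -- A record, so that φ can be inferred from it: _⊨_ is not injective in φ.
  record StutterInvariant (φ : Formula AP) : Set₁ where
    constructor stutterInvariant
    field
      stutter-⇔ : Stutter-⇔ φ

  open StutterInvariant

  suffix-transfer : ∀ {φ T f k j} → StutterInvariant φ → StrictlyIncreasing f →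
                    IsTeamStutteringFn f T → InBlock f k j →
                    (teamSuffix AP j T ⊨ φ) ⇔ (teamSuffix AP k (stutterTeam T f) ⊨ φ)
  suffix-transfer {φ} inv f-inc st j∈k =
    ⇔.trans (stutter-⇔ inv shift-inc refl (shift-stuttering f-inc j∈k st))
            (⊨-cong φ (suffix-stutter-≃ f-inc j∈k st))
    where open Shift f-inc j∈k

  singleton-transfer : ∀ {φ f s t} → StutterInvariant φ → IsStutteringFn f t → s ≈ t ∘ f →
                       (singleton AP t ⊨ φ) ⇔ (singleton AP s ⊨ φ)
  singleton-transfer {φ} inv st@(f-inc , f0 , _) s≈t∘f =
    ⇔.trans (stutter-⇔ inv f-inc f0 (singleton-stuttering st)) (⊨-cong φ (stutterTeam-singleton-≃ s≈t∘f))

  atom-stutter-⇔ : ∀ p → Stutter-⇔ (atom p)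
  atom-stutter-⇔ p {f = f} _ f0 _ = mk⇔
    (λ (lift T⊨p) → lift λ s (t , Tt , s≈t∘f) →
       trans (s≈t∘f 0 p) (subst (λ n → t n p ≡ true) (sym f0) (T⊨p t Tt)))
    (λ (lift T[f]⊨p) → lift λ t Tt →
       subst (λ n → t n p ≡ true) f0 (T[f]⊨p (t ∘ f) (t , Tt , ≈-refl)))

  ¬-stutter-⇔ : ∀ {φ} → StutterInvariant φ → Stutter-⇔ (¬' φ)
  ¬-stutter-⇔ inv {f = f} _ _ st = mk⇔
    (λ T⊨¬φ s (t , Tt , s≈t∘f) s⊨φ →
       T⊨¬φ t Tt (from (singleton-transfer inv (st t Tt) s≈t∘f) s⊨φ))
    (λ T[f]⊨¬φ t Tt t⊨φ →
       T[f]⊨¬φ (t ∘ f) (t , Tt , ≈-refl) (to (singleton-transfer inv (st t Tt) ≈-refl) t⊨φ))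

  ∨-stutter-⇔ : ∀ {φ ψ} → StutterInvariant φ → StutterInvariant ψ → Stutter-⇔ (φ ∨' ψ)
  ∨-stutter-⇔ {φ} {ψ} inv-φ inv-ψ {T} {f} f-inc f0 st = mk⇔ split-stuttered split-original
    where
      split-stuttered : T ⊨ (φ ∨' ψ) → stutterTeam T f ⊨ (φ ∨' ψ)
      split-stuttered (S₁ , S₂ , lift T≐S , S₁⊨φ , S₂⊨ψ) =
        stutterTeam S₁ f , stutterTeam S₂ f , lift (stutterTeam-∪ T≐S) ,
        to (stutter-⇔ inv-φ f-inc f0 (stuttering-⊆ (∪-⊆ˡ T≐S) st)) S₁⊨φ ,
        to (stutter-⇔ inv-ψ f-inc f0 (stuttering-⊆ (∪-⊆ʳ T≐S) st)) S₂⊨ψ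

      _stutters-to_ : Trace AP → Trace AP → Set
      s stutters-to t = s ≈ t ∘ f

      split-original : stutterTeam T f ⊨ (φ ∨' ψ) → T ⊨ (φ ∨' ψ)
      split-original (S₁ , S₂ , lift T[f]≐S , S₁⊨φ , S₂⊨ψ) =
        restrict _stutters-to_ T S₁ , restrict _stutters-to_ T S₂ ,
        lift (restrict-∪ _stutters-to_ (λ t Tt → t ∘ f , (t , Tt , ≈-refl) , ≈-refl) T[f]≐S) ,
        from (stutter-⇔ inv-φ f-inc f0 (stuttering-⊆ proj₁ st))
             (⊨-resp-≃ φ (≃-sym (stutterTeam-restrict-≃ (∪-⊆ˡ T[f]≐S))) S₁⊨φ) ,
        from (stutter-⇔ inv-ψ f-inc f0 (stuttering-⊆ proj₁ st))
             (⊨-resp-≃ ψ (≃-sym (stutterTeam-restrict-≃ (∪-⊆ʳ T[f]≐S))) S₂⊨ψ)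

  F-stutter-⇔ : ∀ {φ} → StutterInvariant φ → Stutter-⇔ (F φ)
  F-stutter-⇔ inv f-inc f0 st = mk⇔
    (λ (j , Tʲ⊨φ) → let k , j∈k = block f-inc f0 j in
       k , to (suffix-transfer inv f-inc st j∈k) Tʲ⊨φ)
    (λ (k , T[f]ᵏ⊨φ) → _ , from (suffix-transfer inv f-inc st (anchor f-inc k)) T[f]ᵏ⊨φ)

  G-stutter-⇔ : ∀ {φ} → StutterInvariant φ → Stutter-⇔ (G φ)
  G-stutter-⇔ inv f-inc f0 st = mk⇔
    (λ T⊨Gφ k → to (suffix-transfer inv f-inc st (anchor f-inc k)) (T⊨Gφ _))
    (λ T[f]⊨Gφ j → let k , j∈k = block f-inc f0 j in
       from (suffix-transfer inv f-inc st j∈k) (T[f]⊨Gφ k))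

  U-stutter-⇔ : ∀ {φ ψ} → StutterInvariant φ → StutterInvariant ψ → Stutter-⇔ (φ U ψ)
  U-stutter-⇔ inv-φ inv-ψ f-inc f0 st = mk⇔
    (λ (j , Tʲ⊨ψ , before) → let k , j∈k = block f-inc f0 j in
       k , to (suffix-transfer inv-ψ f-inc st j∈k) Tʲ⊨ψ ,
       λ m (lift m<k) → to (suffix-transfer inv-φ f-inc st (anchor f-inc m))
                           (before _ (lift (<-block f-inc m<k j∈k))))
    (λ (k , T[f]ᵏ⊨ψ , before) →
       _ , from (suffix-transfer inv-ψ f-inc st (anchor f-inc k)) T[f]ᵏ⊨ψ ,
       λ i (lift i<fk) → let m , i∈m = block f-inc f0 i in
         from (suffix-transfer inv-φ f-inc st i∈m) (before m (lift (block-< f-inc i∈m i<fk))))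

  R-stutter-⇔ : ∀ {φ ψ} → StutterInvariant φ → StutterInvariant ψ → Stutter-⇔ (φ R ψ)
  R-stutter-⇔ {φ} {ψ} inv-φ inv-ψ {T} {f} f-inc f0 st = mk⇔ forward backward
    where
      forward : T ⊨ (φ R ψ) → stutterTeam T f ⊨ (φ R ψ)
      forward T⊨φRψ k with T⊨φRψ (f k)
      ... | inj₁ Tᶠᵏ⊨ψ = inj₁ (to (suffix-transfer inv-ψ f-inc st (anchor f-inc k)) Tᶠᵏ⊨ψ)
      ... | inj₂ (i , lift i<fk , Tⁱ⊨φ) = let m , i∈m = block f-inc f0 i in
        inj₂ (m , lift (block-< f-inc i∈m i<fk) , to (suffix-transfer inv-φ f-inc st i∈m) Tⁱ⊨φ)

      backward : stutterTeam T f ⊨ (φ R ψ) → T ⊨ (φ R ψ)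
      backward T[f]⊨φRψ j with block f-inc f0 j
      ... | k , j∈k with T[f]⊨φRψ k
      ... | inj₁ T[f]ᵏ⊨ψ = inj₁ (from (suffix-transfer inv-ψ f-inc st j∈k) T[f]ᵏ⊨ψ)
      ... | inj₂ (m , lift m<k , T[f]ᵐ⊨φ) =
        inj₂ (f m , lift (<-block f-inc m<k j∈k) ,
              from (suffix-transfer inv-φ f-inc st (anchor f-inc m)) T[f]ᵐ⊨φ)

  xFree⇒stutterInvariant : ∀ {φ} → XFree φ → StutterInvariant φ
  xFree⇒stutterInvariant (atom p)        = stutterInvariant (atom-stutter-⇔ p)
  xFree⇒stutterInvariant (neg xf)        = stutterInvariant (¬-stutter-⇔ (xFree⇒stutterInvariant xf))
  xFree⇒stutterInvariant (and xf xg)     = stutterInvariant λ f-inc f0 st →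
    stutter-⇔ (xFree⇒stutterInvariant xf) f-inc f0 st ×-⇔
    stutter-⇔ (xFree⇒stutterInvariant xg) f-inc f0 st
  xFree⇒stutterInvariant (or xf xg)      =
    stutterInvariant (∨-stutter-⇔ (xFree⇒stutterInvariant xf) (xFree⇒stutterInvariant xg))
  xFree⇒stutterInvariant (fut xf)        = stutterInvariant (F-stutter-⇔ (xFree⇒stutterInvariant xf))
  xFree⇒stutterInvariant (glob xf)       = stutterInvariant (G-stutter-⇔ (xFree⇒stutterInvariant xf))
  xFree⇒stutterInvariant (until xf xg)   =
    stutterInvariant (U-stutter-⇔ (xFree⇒stutterInvariant xf) (xFree⇒stutterInvariant xg))
  xFree⇒stutterInvariant (release xf xg) =
    stutterInvariant (R-stutter-⇔ (xFree⇒stutterInvariant xf) (xFree⇒stutterInvariant xg))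
  xFree⇒stutterInvariant (sim xf)        = stutterInvariant λ f-inc f0 st →
    ¬-cong-⇔ (stutter-⇔ (xFree⇒stutterInvariant xf) f-inc f0 st)

  strictify-≗-on : ∀ {f} {T : Team AP} → IsTeamStutteringFn f T → ∀ t → T t → strictify f ≗ f
  strictify-≗-on st t Tt = let f-inc , f0 , _ = st t Tt in strictify-≗ f-inc f0

  strictify-stuttering : ∀ {f} {T : Team AP} → IsTeamStutteringFn f T →
                         IsTeamStutteringFn (strictify f) T
  strictify-stuttering st t Tt = IsStutteringFn-resp-≗ (strictify-≗-on st t Tt) (st t Tt)

  xFree⇒stutter-⇔ : ∀ {φ T f} → XFree φ → IsTeamStutteringFn f T →
                    (T ⊨ φ) ⇔ (stutterTeam T f ⊨ φ)
  xFree⇒stutter-⇔ {φ} {f = f} xf st =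
    ⇔.trans (stutter-⇔ (xFree⇒stutterInvariant xf) (strictify-inc f) refl (strictify-stuttering st))
            (⊨-cong φ (stutterTeam-cong (strictify-≗-on st)))

theorem26 : {AP : Set} (φ : Formula AP) → XFree φ →
    (T T' : Team AP) → T ≡st T' → (T ⊨ φ) ⇔ (T' ⊨ φ)
theorem26 φ xf T T' (f , f' , st , st' , T[f]≐T'[f']) =
  ⇔.trans (xFree⇒stutter-⇔ xf st)
          (⇔.trans (⊨-cong φ (≐⇒≃ T[f]≐T'[f'])) (⇔.sym (xFree⇒stutter-⇔ xf st')))
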